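{- Let $a_1,a_2,\dots,a_t$ be an arbitrary sequence of integers and let $b>0$ be an integer. Then there exist at least $$\frac{1}{b+1}(a_t-a_1)-\sum_{i=1}^{t-1}\max\{a_{i+1}-a_i-b,\,0\}$$ different integers $q\in[a_1,a_t]$ with the property that there exists an index $i$ with $a_i,a_{i+1}\in[q-b,q+b]$. -}

module Defs where

open import Data.Nat using (ℕ; zero; suc)
open import Data.Fin using (Fin; zero; suc)
open import Data.Integer using (ℤ; _+_; _-_; _≤_; _⊔_; 0ℤ)

sumℤ : (n : ℕ) → (Fin n → ℤ) → ℤ
sumℤ zero    f = 0ℤ
sumℤ (suc n) f = f zero + sumℤ n (λ i → f (suc i))

_∈[_,_] : ℤ → ℤ → ℤ → Set
x ∈[ lo , hi ] = (lo ≤ x) Data.Product.× (x ≤ hi)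
  where import Data.Product

-- A point q with a_i ≤ q ≤ a_{i+1} ≤ a_i + b is covered by the step i.  Scan the
-- sequence from the left, keeping a lower end L not below the minimum of the
-- remaining suffix a_i, …, a_t.  If L is below the minimum M of a_{i+1}, …, a_t,
-- then a_i ≤ L < M ≤ a_{i+1}, so the points of [L, M) are either all covered by
-- step i (when a_{i+1} ≤ a_i + b) or jumped over by a rise of
-- a_{i+1} - a_i ≤ (b + 1) · max(a_{i+1} - a_i - b, 0).  Summing gives the
-- stronger bound (a_t - a_1) - (b + 1) · Σ max(a_{i+1} - a_i - b, 0) ≤ #points.
module Submission where

open import Defs
open import Function using (_∘_)
open import Data.Nat using (ℕ; zero; suc)
open import Data.Fin using (Fin; zero; suc; inject₁; fromℕ)
open import Data.Integer
  using (ℤ; +_; _+_; _-_; -_; _*_; _≤_; _<_; _≰_; _⊓_; _⊔_; 0ℤ; 1ℤ; ∣_∣; +<+; _≤?_; NonNegative; nonNegative)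
open import Data.Integer.Properties
open import Data.Integer.Tactic.RingSolver using (solve-∀)
open import Data.List using (List; []; _++_; length; applyUpTo)
open import Data.List.Properties using (length-++; length-applyUpTo)
open import Data.List.Relation.Unary.All using (All; []) renaming (map to All-map; lookup to All-lookup)
import Data.List.Relation.Unary.All.Properties as All
open import Data.List.Relation.Unary.Unique.Propositional using (Unique)
open import Data.List.Relation.Unary.AllPairs using ([])
import Data.List.Relation.Unary.Unique.Propositional.Properties as Unique
open import Data.List.Relation.Binary.Disjoint.Propositional using (Disjoint)
open import Data.Product using (Σ; ∃; _×_; _,_; proj₁; proj₂)
open import Data.Sum using (inj₁; inj₂)
open import Relation.Nullary using (yes; no; contradiction)
open import Relation.Binary.PropositionalEquality using (_≡_; sym; trans; cong; subst; subst₂)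

range : ℤ → ℤ → List ℤ
range L M = applyUpTo (λ i → L + + i) ∣ M - L ∣

module _ {L M : ℤ} (L≤M : L ≤ M) where

  +∣M-L∣≡M-L : + ∣ M - L ∣ ≡ M - L
  +∣M-L∣≡M-L = 0≤i⇒+∣i∣≡i (i≤j⇒0≤j-i L≤M)

  length-range : + length (range L M) ≡ M - L
  length-range = trans (cong +_ (length-applyUpTo _ ∣ M - L ∣)) +∣M-L∣≡M-L

  range-⊆ : All (λ q → L ≤ q × q < M) (range L M)
  range-⊆ = All.applyUpTo⁺₁ _ ∣ M - L ∣ λ {i} i<k →
    i≤i+j L (+ i) ,
    subst (L + + i <_) (i+[j-i]≡j L M) (+-monoʳ-< L (subst (+ i <_) +∣M-L∣≡M-L (+<+ i<k)))
    where
    i+[j-i]≡j : ∀ i j → i + (j - i) ≡ j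
    i+[j-i]≡j = solve-∀

range-unique : ∀ L M → Unique (range L M)
range-unique L M = Unique.applyUpTo⁺₁ _ ∣ M - L ∣ λ i<j _ → <⇒≢ (+-monoʳ-< L (+<+ i<j))

minimum : ∀ n → (Fin (suc n) → ℤ) → ℤ
minimum zero    a = a zero
minimum (suc n) a = a zero ⊓ minimum n (a ∘ suc)

minimum≤head : ∀ n (a : Fin (suc n) → ℤ) → minimum n a ≤ a zero
minimum≤head zero    a = ≤-refl
minimum≤head (suc n) a = i⊓j≤i (a zero) _

minimum≤last : ∀ n (a : Fin (suc n) → ℤ) → minimum n a ≤ a (fromℕ n)
minimum≤last zero    a = ≤-refl
minimum≤last (suc n) a = ≤-trans (i⊓j≤j (a zero) _) (minimum≤last n (a ∘ suc))

i⊓j≤k∧j≰k⇒i≤k : ∀ {i j k} → i ⊓ j ≤ k → j ≰ k → i ≤ k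
i⊓j≤k∧j≰k⇒i≤k {i} {j} i⊓j≤k j≰k with ⊓-sel i j
... | inj₁ i⊓j≡i = subst (_≤ _) i⊓j≡i i⊓j≤k
... | inj₂ i⊓j≡j = contradiction (subst (_≤ _) i⊓j≡j i⊓j≤k) j≰k

module _ (b : ℤ) .{{_ : NonNegative b}} where

  private instance
    b+1-nonNeg : NonNegative (b + 1ℤ)
    b+1-nonNeg = nonNegative (≤-trans (nonNegative⁻¹ b) (i≤i+j b 1ℤ))

  ∈-window : ∀ {x y q} → x ≤ q → q ≤ y → y ≤ x + b →
             x ∈[ q - b , q + b ] × y ∈[ q - b , q + b ]
  ∈-window {x} {y} {q} x≤q q≤y y≤x+b =
    (q-b≤x , ≤-trans x≤q (i≤i+j q b)) , (≤-trans (i-j≤i q b) q≤y , ≤-trans y≤x+b (+-monoˡ-≤ b x≤q))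
    where
    q-b≤x : q - b ≤ x
    q-b≤x = subst (q - b ≤_) ([i+j]-j≡i x b) (+-monoˡ-≤ (- b) (≤-trans q≤y y≤x+b))
      where
      [i+j]-j≡i : ∀ i j → (i + j) - j ≡ i
      [i+j]-j≡i = solve-∀

  excess : ℤ → ℤ → ℤ
  excess x y = (y - x - b) ⊔ 0ℤ

  totalExcess : ∀ n → (Fin (suc n) → ℤ) → ℤ
  totalExcess n a = sumℤ n (λ i → excess (a (inject₁ i)) (a (suc i)))

  excess-nonNeg : ∀ x y → 0ℤ ≤ excess x y
  excess-nonNeg x y = i≤j⇒i≤k⊔j _ ≤-refl

  i-[b+1]*j≤i : ∀ i {j} → 0ℤ ≤ j → i - (b + 1ℤ) * j ≤ i
  i-[b+1]*j≤i i {j} 0≤j = i-j≤i i _ {{nonNegative [b+1]*j≥0}}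
    where
    [b+1]*j≥0 : 0ℤ ≤ (b + 1ℤ) * j
    [b+1]*j≥0 = subst (_≤ (b + 1ℤ) * j) (*-zeroʳ (b + 1ℤ)) (*-monoˡ-≤-nonNeg (b + 1ℤ) 0≤j)

  n≤[b+1]*n : ∀ n → + n ≤ (b + 1ℤ) * + n
  n≤[b+1]*n n = subst (_≤ (b + 1ℤ) * + n) (*-identityˡ (+ n)) (*-monoʳ-≤-nonNeg (+ n) (i≤j⇒i≤k+j b ≤-refl))

  gap≤[b+1]*excess : ∀ {x y} → x + b < y → y - x ≤ (b + 1ℤ) * excess x y
  gap≤[b+1]*excess {x} {y} x+b<y = begin
    y - x              ≡⟨ split x y b ⟩
    b * 1ℤ + d         ≤⟨ +-monoˡ-≤ d (*-monoˡ-≤-nonNeg b 1≤d) ⟩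
    b * d + d          ≡⟨ merge b d ⟩
    (b + 1ℤ) * d       ≡⟨ cong ((b + 1ℤ) *_) (sym (i≥j⇒i⊔j≡i (<⇒≤ 0<d))) ⟩
    (b + 1ℤ) * excess x y ∎
    where
    open ≤-Reasoning
    d = y - x - b
    0<d : 0ℤ < d
    0<d = subst₂ _<_ (+-inverseʳ (x + b)) (regroup y x b) (+-monoˡ-< (- (x + b)) x+b<y)
      where
      regroup : ∀ y x b → y - (x + b) ≡ y - x - b
      regroup = solve-∀
    1≤d : 1ℤ ≤ d
    1≤d = i<j⇒suc[i]≤j 0<d
    split : ∀ x y b → y - x ≡ b * 1ℤ + (y - x - b)
    split = solve-∀
    merge : ∀ b d → b * d + d ≡ (b + 1ℤ) * d
    merge = solve-∀

  step-covers : ∀ {x y L M} → x ≤ L → L ≤ M → M ≤ y →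
    Σ (List ℤ) λ E → Unique E
      × All (λ q → (L ≤ q × q < M) × x ∈[ q - b , q + b ] × y ∈[ q - b , q + b ]) E
      × (M - L) - (b + 1ℤ) * excess x y ≤ + length E
  step-covers {x} {y} {L} {M} x≤L L≤M M≤y with y ≤? x + b
  ... | yes y≤x+b = range L M , range-unique L M , All-map in-window (range-⊆ L≤M) , bound
    where
    in-window : ∀ {q} → L ≤ q × q < M → (L ≤ q × q < M) × x ∈[ q - b , q + b ] × y ∈[ q - b , q + b ]
    in-window (L≤q , q<M) = (L≤q , q<M) , ∈-window (≤-trans x≤L L≤q) (≤-trans (<⇒≤ q<M) M≤y) y≤x+b
    bound : (M - L) - (b + 1ℤ) * excess x y ≤ + length (range L M)
    bound = subst ((M - L) - (b + 1ℤ) * excess x y ≤_) (sym (length-range L≤M))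
                  (i-[b+1]*j≤i (M - L) (excess-nonNeg x y))
  ... | no y≰x+b = [] , [] , [] ,
    i≤j⇒i-j≤0 (≤-trans (+-mono-≤ M≤y (neg-mono-≤ x≤L)) (gap≤[b+1]*excess (≰⇒> y≰x+b)))

  Covered : ∀ n → (Fin (suc n) → ℤ) → ℤ → Set
  Covered n a q = ∃ λ (i : Fin n) → (a (inject₁ i) ∈[ q - b , q + b ]) × (a (suc i) ∈[ q - b , q + b ])

  record CoveringFrom (n : ℕ) (a : Fin (suc n) → ℤ) (L : ℤ) : Set where
    field
      points  : List ℤ
      unique  : Unique points
      covered : All (λ q → q ∈[ L , a (fromℕ n) ] × Covered n a q) points
      bound   : (a (fromℕ n) - L) - (b + 1ℤ) * totalExcess n a ≤ + length points

  prepend : ∀ {n} {a : Fin (suc (suc n)) → ℤ} {L M} (E : List ℤ) → Unique E →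
    All (λ q → (q ∈[ L , a (fromℕ (suc n)) ] × Covered (suc n) a q) × q < M) E →
    L ≤ M → (M - L) - (b + 1ℤ) * excess (a zero) (a (suc zero)) ≤ + length E →
    CoveringFrom n (a ∘ suc) M → CoveringFrom (suc n) a L
  prepend {n} {a} {L} {M} E E-unique E-covered L≤M E-bound C = record
    { points  = E ++ points
    ; unique  = Unique.++⁺ E-unique unique disjoint
    ; covered = All.++⁺ (All-map proj₁ E-covered) (All-map shift covered)
    ; bound   = subst₂ _≤_ (telescope (a (fromℕ (suc n))) M L (b + 1ℤ) _ _) length-E++points
                           (+-mono-≤ E-bound bound)
    }
    where
    open CoveringFrom C
    disjoint : Disjoint E points
    disjoint (q∈E , q∈points) =
      <⇒≱ (proj₂ (All-lookup E-covered q∈E)) (proj₁ (proj₁ (All-lookup covered q∈points)))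
    shift : ∀ {q} → q ∈[ M , a (fromℕ (suc n)) ] × Covered n (a ∘ suc) q →
                    q ∈[ L , a (fromℕ (suc n)) ] × Covered (suc n) a q
    shift ((M≤q , q≤last) , i , window) = (≤-trans L≤M M≤q , q≤last) , suc i , window
    telescope : ∀ X M L c h S → ((M - L) - c * h) + ((X - M) - c * S) ≡ (X - L) - c * (h + S)
    telescope = solve-∀
    length-E++points : + length E + + length points ≡ + length (E ++ points)
    length-E++points = trans (sym (pos-+ (length E) (length points))) (cong +_ (sym (length-++ E)))

  coveringFrom : ∀ n (a : Fin (suc n) → ℤ) L → minimum n a ≤ L → CoveringFrom n a L
  coveringFrom zero a L a₀≤L = record
    { points  = []
    ; unique  = []
    ; covered = []
    ; bound   = ≤-trans (i-[b+1]*j≤i (a zero - L) ≤-refl) (i≤j⇒i-j≤0 a₀≤L)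
    }
  coveringFrom (suc n) a L min≤L with minimum n (a ∘ suc) ≤? L
  ... | yes m≤L = prepend [] [] [] ≤-refl bound (coveringFrom n (a ∘ suc) L m≤L)
    where
    bound : (L - L) - (b + 1ℤ) * excess (a zero) (a (suc zero)) ≤ 0ℤ
    bound = ≤-trans (i-[b+1]*j≤i (L - L) (excess-nonNeg (a zero) (a (suc zero))))
                    (≤-reflexive (+-inverseʳ L))
  ... | no m≰L with step-covers (i⊓j≤k∧j≰k⇒i≤k min≤L m≰L) (<⇒≤ (≰⇒> m≰L)) (minimum≤head n (a ∘ suc))
  ...   | E , E-unique , E-covered , E-bound =
    prepend E E-unique (All-map widen E-covered) (<⇒≤ (≰⇒> m≰L)) E-bound
            (coveringFrom n (a ∘ suc) (minimum n (a ∘ suc)) ≤-refl)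
    where
    widen : ∀ {q} → (L ≤ q × q < minimum n (a ∘ suc)) × a zero ∈[ q - b , q + b ] × a (suc zero) ∈[ q - b , q + b ] →
            (q ∈[ L , a (fromℕ (suc n)) ] × Covered (suc n) a q) × q < minimum n (a ∘ suc)
    widen ((L≤q , q<m) , window) =
      ((L≤q , ≤-trans (<⇒≤ q<m) (minimum≤last n (a ∘ suc))) , zero , window) , q<m

mainTheorem3 : (n : ℕ) (a : Fin (suc n) → ℤ) (b : ℤ) → 0ℤ < b →
    Σ (List ℤ) λ qs →
      Unique qs
      × All (λ q → (q ∈[ a zero , a (fromℕ n) ])
                   × ∃ λ (i : Fin n) → (a (inject₁ i) ∈[ q - b , q + b ]) × (a (suc i) ∈[ q - b , q + b ])) qs
      × ((a (fromℕ n) - a zero) - (b + 1ℤ) * sumℤ n (λ i → (a (suc i) - a (inject₁ i) - b) ⊔ 0ℤ)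
          ≤ (b + 1ℤ) * (+ length qs))
mainTheorem3 n a b 0<b = points , unique , covered , ≤-trans bound (n≤[b+1]*n b (length points))
  where
  instance
    b-nonNeg : NonNegative b
    b-nonNeg = nonNegative (<⇒≤ 0<b)
  open CoveringFrom (coveringFrom b n a (a zero) (minimum≤head n a))
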